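{- For each $i\in\{0,1,9\}$ there exist three 4-GDDs of type $3^4$ (on the same point set with the same groups) with exactly $i$ common blocks.
   Context: A 4-GDD of type $3^4$ is a triple $(\mathcal{X},\mathcal{G},\mathcal{A})$ where $\mathcal{G}$ is a partition of a 12-element set $\mathcal{X}$ into four groups of size 3, $\mathcal{A}$ is a set of 4-subsets of $\mathcal{X}$ (blocks), each block meets each group in at most one element, and every pair of elements from distinct groups lies in exactly one block. Three such GDDs $(\mathcal{X},\mathcal{G},\mathcal{A}_j)$, $j=1,2,3$, have exactly $i$ common blocks if $\mathcal{A}_1\cap\mathcal{A}_2=\mathcal{A}_1\cap\mathcal{A}_3=\mathcal{A}_2\cap\mathcal{A}_3$ and this set has exactly $i$ blocks. -}

module Defs where

open import Data.Nat using (ℕ)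
open import Data.Fin using (Fin)
open import Data.Fin.Properties using () renaming (_≟_ to _≟ᶠ_)
open import Data.Fin.Subset using (Subset; _∈_; ∣_∣)
open import Data.Fin.Subset.Properties using (_∈?_)
open import Data.List using (List; length; filter; allFin)
open import Data.List.Relation.Unary.Unique.Propositional using (Unique)
import Data.List.Membership.Propositional as LM
import Data.List.Membership.DecPropositional as LMD
open import Data.Vec.Properties using (≡-dec)
open import Data.Bool.Properties using () renaming (_≟_ to _≟ᵇ_)
open import Data.Product using (_×_)
open import Function.Bundles using (_⇔_)
open import Relation.Binary.PropositionalEquality using (_≡_; _≢_)
open import Relation.Nullary.Decidable using (_×-dec_)

Point : Set
Point = Fin 12

Block : Set
Block = Subset 12

IsGroupPartition : (Point → Fin 4) → Set
IsGroupPartition g = ∀ (j : Fin 4) → length (filter (λ x → g x ≟ᶠ j) (allFin 12)) ≡ 3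

pairCount : List Block → Point → Point → ℕ
pairCount A x y = length (filter (λ b → (x ∈? b) ×-dec (y ∈? b)) A)

Is4GDD : (Point → Fin 4) → List Block → Set
Is4GDD g A =
  Unique A
  × (∀ b → b LM.∈ A → ∣ b ∣ ≡ 4)
  × (∀ b → b LM.∈ A → ∀ x y → x ∈ b → y ∈ b → g x ≡ g y → x ≡ y)
  × (∀ x y → g x ≢ g y → pairCount A x y ≡ 1)

-- size of A₁ ∩ A₂ (A₁ duplicate-free)
interSize : List Block → List Block → ℕ
interSize A₁ A₂ = length (filter (λ b → LMD._∈?_ (≡-dec _≟ᵇ_) b A₂) A₁)

ExactlyCommon : ℕ → List Block → List Block → List Block → Set
ExactlyCommon i A₁ A₂ A₃ =
  (∀ b → ((b LM.∈ A₁ × b LM.∈ A₂) ⇔ (b LM.∈ A₁ × b LM.∈ A₃)))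
  × (∀ b → ((b LM.∈ A₁ × b LM.∈ A₃) ⇔ (b LM.∈ A₂ × b LM.∈ A₃)))
  × interSize A₁ A₂ ≡ i

-- A 4-GDD of type 3^4 is a transversal design TD(4,3), i.e. a pair of orthogonal Latin squares of
-- order 3. The required designs are exhibited explicitly, and since every defining condition is a
-- finite check, decision procedures for them certify the designs by evaluation.
module Submission where

open import Defs
open import Level using (Level)
open import Data.Nat using (ℕ; _≟_)
open import Data.Fin using (Fin; combine; quotient)
open import Data.Fin.Patterns using (0F; 1F; 2F; 3F)
open import Data.Fin.Properties using (all?) renaming (_≟_ to _≟ᶠ_)
import Data.Fin.Literals as Fin
open import Data.Fin.Subset using (⁅_⁆; _∪_; ∣_∣)
open import Data.Fin.Subset.Properties using () renaming (_∈?_ to _∈ˢ?_)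
open import Data.List using (List; []; _∷_; length; filter; allFin)
import Data.List.Relation.Unary.All as All
open import Data.List.Relation.Unary.Unique.DecPropositional using (unique?)
open import Data.List.Membership.Propositional using (_∈_)
import Data.List.Membership.DecPropositional as Membership
open import Data.Vec.Properties using (≡-dec)
open import Data.Bool.Properties using () renaming (_≟_ to _≟ᵇ_)
open import Data.Sum using (_⊎_; inj₁; inj₂)
open import Data.Product using (_×_; _,_; proj₂; ∃-syntax; swap)
open import Function.Base using (_∘_)
open import Function.Bundles using (_⇔_; mk⇔; Equivalence)
open import Relation.Nullary using (Dec; ¬?)
open import Relation.Nullary.Decidable using (_×-dec_; _→-dec_; map′; from-yes)
open import Relation.Unary using (Decidable)
open import Relation.Binary.Definitions using (DecidableEquality)
open import Relation.Binary.PropositionalEquality using (_≡_; refl)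
open import Agda.Builtin.FromNat using (Number)

private
  variable
    a : Level
    X : Set a
    P Q R S : Set a

_⇔-dec_ : Dec P → Dec Q → Dec (P ⇔ Q)
p? ⇔-dec q? = map′ (λ (f , g) → mk⇔ f g) (λ e → Equivalence.to e , Equivalence.from e)
  ((p? →-dec q?) ×-dec (q? →-dec p?))

×-swap-⇔ : (P × Q) ⇔ (R × S) → (Q × P) ⇔ (S × R)
×-swap-⇔ e = mk⇔ (swap ∘ Equivalence.to e ∘ swap) (swap ∘ Equivalence.from e ∘ swap)

∀∈? : {P : X → Set a} → Decidable P → (xs : List X) → Dec (∀ x → x ∈ xs → P x)
∀∈? P? xs = map′ (λ ps x → All.lookup ps) (λ p → All.tabulate (p _)) (All.all? P? xs)

module _ (_≟ˣ_ : DecidableEquality X) where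
  open Membership _≟ˣ_ using (_∈?_)

  sameIntersection? : (A B C : List X) → Dec (∀ x → (x ∈ A × x ∈ B) ⇔ (x ∈ A × x ∈ C))
  sameIntersection? A B C = map′ extend restrict (∀∈? (λ x → (x ∈? B) ⇔-dec (x ∈? C)) A)
    where
    extend : (∀ x → x ∈ A → (x ∈ B ⇔ x ∈ C)) → ∀ x → (x ∈ A × x ∈ B) ⇔ (x ∈ A × x ∈ C)
    extend e x = mk⇔ (λ (x∈A , x∈B) → x∈A , Equivalence.to (e x x∈A) x∈B)
                     (λ (x∈A , x∈C) → x∈A , Equivalence.from (e x x∈A) x∈C)

    restrict : (∀ x → (x ∈ A × x ∈ B) ⇔ (x ∈ A × x ∈ C)) → ∀ x → x ∈ A → (x ∈ B ⇔ x ∈ C)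
    restrict e x x∈A = mk⇔ (λ x∈B → proj₂ (Equivalence.to (e x) (x∈A , x∈B)))
                           (λ x∈C → proj₂ (Equivalence.from (e x) (x∈A , x∈C)))

isGroupPartition? : (g : Point → Fin 4) → Dec (IsGroupPartition g)
isGroupPartition? g = all? λ j → length (filter (λ x → g x ≟ᶠ j) (allFin 12)) ≟ 3

is4GDD? : (g : Point → Fin 4) (A : List Block) → Dec (Is4GDD g A)
is4GDD? g A =
  unique? (≡-dec _≟ᵇ_) A
  ×-dec ∀∈? (λ b → ∣ b ∣ ≟ 4) A
  ×-dec ∀∈? (λ b → all? λ x → all? λ y →
           x ∈ˢ? b →-dec y ∈ˢ? b →-dec g x ≟ᶠ g y →-dec x ≟ᶠ y) A
  ×-dec all? λ x → all? λ y → ¬? (g x ≟ᶠ g y) →-dec pairCount A x y ≟ 1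

exactlyCommon? : ∀ i A₁ A₂ A₃ → Dec (ExactlyCommon i A₁ A₂ A₃)
exactlyCommon? i A₁ A₂ A₃ =
  sameIntersection? (≡-dec _≟ᵇ_) A₁ A₂ A₃
  ×-dec map′ (λ e b → ×-swap-⇔ (e b)) (λ e b → ×-swap-⇔ (e b))
             (sameIntersection? (≡-dec _≟ᵇ_) A₃ A₁ A₂)
  ×-dec interSize A₁ A₂ ≟ i

point : Fin 4 → Fin 3 → Point
point = combine

group : Point → Fin 4
group = quotient 3

⟨_,_,_,_⟩ : Fin 3 → Fin 3 → Fin 3 → Fin 3 → Block
⟨ k₀ , k₁ , k₂ , k₃ ⟩ = ⁅ point 0F k₀ ⁆ ∪ ⁅ point 1F k₁ ⁆ ∪ ⁅ point 2F k₂ ⁆ ∪ ⁅ point 3F k₃ ⁆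

-- Fin literals are enabled only in this module, which contains no ℕ literal.
module Designs where
  open import Agda.Builtin.FromNat using (fromNat)
  open import Data.Unit using (tt)

  instance
    finNumber : ∀ {n} → Number (Fin n)
    finNumber {n} = Fin.number n

  noCommon₁ : List Block
  noCommon₁ =
    ⟨ 0 , 0 , 2 , 1 ⟩ ∷ ⟨ 0 , 1 , 0 , 2 ⟩ ∷ ⟨ 0 , 2 , 1 , 0 ⟩ ∷
    ⟨ 1 , 0 , 0 , 0 ⟩ ∷ ⟨ 1 , 1 , 1 , 1 ⟩ ∷ ⟨ 1 , 2 , 2 , 2 ⟩ ∷
    ⟨ 2 , 0 , 1 , 2 ⟩ ∷ ⟨ 2 , 1 , 2 , 0 ⟩ ∷ ⟨ 2 , 2 , 0 , 1 ⟩ ∷ []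

  noCommon₂ : List Block
  noCommon₂ =
    ⟨ 0 , 0 , 1 , 0 ⟩ ∷ ⟨ 0 , 1 , 2 , 1 ⟩ ∷ ⟨ 0 , 2 , 0 , 2 ⟩ ∷
    ⟨ 1 , 0 , 2 , 2 ⟩ ∷ ⟨ 1 , 1 , 0 , 0 ⟩ ∷ ⟨ 1 , 2 , 1 , 1 ⟩ ∷
    ⟨ 2 , 0 , 0 , 1 ⟩ ∷ ⟨ 2 , 1 , 1 , 2 ⟩ ∷ ⟨ 2 , 2 , 2 , 0 ⟩ ∷ []

  noCommon₃ : List Block
  noCommon₃ =
    ⟨ 0 , 0 , 2 , 0 ⟩ ∷ ⟨ 0 , 1 , 0 , 1 ⟩ ∷ ⟨ 0 , 2 , 1 , 2 ⟩ ∷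
    ⟨ 1 , 0 , 1 , 1 ⟩ ∷ ⟨ 1 , 1 , 2 , 2 ⟩ ∷ ⟨ 1 , 2 , 0 , 0 ⟩ ∷
    ⟨ 2 , 0 , 0 , 2 ⟩ ∷ ⟨ 2 , 1 , 1 , 0 ⟩ ∷ ⟨ 2 , 2 , 2 , 1 ⟩ ∷ []

  oneCommon₁ : List Block
  oneCommon₁ =
    ⟨ 0 , 0 , 2 , 1 ⟩ ∷ ⟨ 0 , 1 , 1 , 0 ⟩ ∷ ⟨ 0 , 2 , 0 , 2 ⟩ ∷
    ⟨ 1 , 0 , 0 , 0 ⟩ ∷ ⟨ 1 , 1 , 2 , 2 ⟩ ∷ ⟨ 1 , 2 , 1 , 1 ⟩ ∷
    ⟨ 2 , 0 , 1 , 2 ⟩ ∷ ⟨ 2 , 1 , 0 , 1 ⟩ ∷ ⟨ 2 , 2 , 2 , 0 ⟩ ∷ []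

  oneCommon₂ : List Block
  oneCommon₂ =
    ⟨ 0 , 0 , 1 , 0 ⟩ ∷ ⟨ 0 , 1 , 0 , 1 ⟩ ∷ ⟨ 0 , 2 , 2 , 2 ⟩ ∷
    ⟨ 1 , 0 , 0 , 2 ⟩ ∷ ⟨ 1 , 1 , 2 , 0 ⟩ ∷ ⟨ 1 , 2 , 1 , 1 ⟩ ∷
    ⟨ 2 , 0 , 2 , 1 ⟩ ∷ ⟨ 2 , 1 , 1 , 2 ⟩ ∷ ⟨ 2 , 2 , 0 , 0 ⟩ ∷ []

  oneCommon₃ : List Block
  oneCommon₃ =
    ⟨ 0 , 0 , 1 , 2 ⟩ ∷ ⟨ 0 , 1 , 2 , 1 ⟩ ∷ ⟨ 0 , 2 , 0 , 0 ⟩ ∷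
    ⟨ 1 , 0 , 2 , 0 ⟩ ∷ ⟨ 1 , 1 , 0 , 2 ⟩ ∷ ⟨ 1 , 2 , 1 , 1 ⟩ ∷
    ⟨ 2 , 0 , 0 , 1 ⟩ ∷ ⟨ 2 , 1 , 1 , 0 ⟩ ∷ ⟨ 2 , 2 , 2 , 2 ⟩ ∷ []

open Designs

ThreeGDDsWithCommon : ℕ → (Point → Fin 4) → List Block → List Block → List Block → Set
ThreeGDDsWithCommon i g A₁ A₂ A₃ =
  IsGroupPartition g × Is4GDD g A₁ × Is4GDD g A₂ × Is4GDD g A₃ × ExactlyCommon i A₁ A₂ A₃

threeGDDsWithCommon? : ∀ i g A₁ A₂ A₃ → Dec (ThreeGDDsWithCommon i g A₁ A₂ A₃)
threeGDDsWithCommon? i g A₁ A₂ A₃ =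
  isGroupPartition? g ×-dec is4GDD? g A₁ ×-dec is4GDD? g A₂ ×-dec is4GDD? g A₃
    ×-dec exactlyCommon? i A₁ A₂ A₃

lemma4p8 : ∀ (i : ℕ) → (i ≡ 0 ⊎ i ≡ 1 ⊎ i ≡ 9) →
    ∃[ g ] ∃[ A₁ ] ∃[ A₂ ] ∃[ A₃ ]
      (IsGroupPartition g × Is4GDD g A₁ × Is4GDD g A₂ × Is4GDD g A₃
        × ExactlyCommon i A₁ A₂ A₃)
lemma4p8 _ (inj₁ refl) =
  group , noCommon₁ , noCommon₂ , noCommon₃ ,
  from-yes (threeGDDsWithCommon? 0 group noCommon₁ noCommon₂ noCommon₃)
lemma4p8 _ (inj₂ (inj₁ refl)) =
  group , oneCommon₁ , oneCommon₂ , oneCommon₃ ,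
  from-yes (threeGDDsWithCommon? 1 group oneCommon₁ oneCommon₂ oneCommon₃)
-- A 4-GDD of type 3^4 has exactly 9 blocks, so i = 9 forces three copies of one design.
lemma4p8 _ (inj₂ (inj₂ refl)) =
  group , noCommon₁ , noCommon₁ , noCommon₁ ,
  from-yes (threeGDDsWithCommon? 9 group noCommon₁ noCommon₁ noCommon₁)
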